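{- Let $\mathsf K$ be a class of FL${}_{\mathrm e}$-algebras in which $1$ is the greatest and $0$ the least element, and let ${\Rightarrow}\in\{\Rightarrow_{\circ},\Rightarrow_{\wedge}\}$. Then ${\Rightarrow}$ is weakly connexive for $\mathsf K$ if and only if ${\Rightarrow}$ is proto-connexive for $\mathsf K$. Moreover, for any subvariety $\mathsf V$ of $\mathsf{FL}_{\mathsf{ew}}$, the class $Q_w(\mathsf V)$ is a variety, namely the subvariety of $\mathsf V$ axiomatized by $1\leq\neg(x{\Rightarrow}\neg x)$.
   Context: An FL${}_{\mathrm e}$-algebra is an algebra $\langle A,\wedge,\vee,\cdot,\to,0,1\rangle$ such that $\langle A,\wedge,\vee\rangle$ is a lattice (with order $\leq$), $\langle A,\cdot,1\rangle$ is a commutative monoid, $0$ is an arbitrary constant, and $x\cdot y\leq z\iff x\leq y\to z$. $\mathsf{FL}_{\mathsf{ew}}$ is the variety of FL${}_{\mathrm e}$-algebras with $1$ greatest and $0$ least. Write $\neg x:=x\to 0$, $x\Rightarrow_{\wedge} y:=(x\to y)\wedge(y\to\neg\neg x)$, $x\Rightarrow_{\circ} y:=(x\to y)\cdot(y\to\neg\neg x)$. ${\Rightarrow}$ is proto-connexive for a class $\mathsf K$ if every member satisfies, for all $x,y$: (AT) $1\leq\neg(x{\Rightarrow}\neg x)$, (AT') $1\leq\neg(\neg x{\Rightarrow} x)$, (BT) $1\leq (x{\Rightarrow} y){\Rightarrow}\neg(x{\Rightarrow}\neg y)$, (BT') $1\leq (x{\Rightarrow}\neg y){\Rightarrow}\neg(x{\Rightarrow}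 y)$. ${\Rightarrow}$ is weakly connexive for $\mathsf K$ if every member satisfies (AT), (AT') and the quasi-identities (BTw) $1\leq x{\Rightarrow} y$ implies $1\leq\neg(x{\Rightarrow}\neg y)$, and (BTw') $1\leq x{\Rightarrow}\neg y$ implies $1\leq\neg(x{\Rightarrow} y)$. For a variety $\mathsf V$, $Q_w(\mathsf V)$ is the quasivariety of members of $\mathsf V$ satisfying (AT), (AT'), (BTw), (BTw') for ${\Rightarrow}$. -}

module Defs where

open import Level using (Level; 0ℓ; _⊔_) renaming (suc to lsuc)
open import Data.Nat using (ℕ)
open import Data.Product using (_×_; _,_)
open import Relation.Binary.PropositionalEquality using (_≡_)
open import Relation.Unary using (Pred; _∪_; _∈_)
open import Algebra.Lattice.Structures using (IsLattice)
open import Algebra.Structures using (IsCommutativeMonoid)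


record FLew : Set₁ where
  field
    Carrier : Set
    _⊓_ _⊔ₗ_ _·_ _⇾_ : Carrier → Carrier → Carrier
    𝟘 𝟙 : Carrier
    isLattice : IsLattice _≡_ _⊔ₗ_ _⊓_
    isCommMonoid : IsCommutativeMonoid _≡_ _·_ 𝟙

  _≤_ : Carrier → Carrier → Set
  x ≤ y = x ⊓ y ≡ x

  field
    residuation-⇒ : ∀ x y z → (x · y) ≤ z → x ≤ (y ⇾ z)
    residuation-⇐ : ∀ x y z → x ≤ (y ⇾ z) → (x · y) ≤ z
    𝟙-top : ∀ x → x ≤ 𝟙
    𝟘-bot : ∀ x → 𝟘 ≤ x

  ¬_ : Carrier → Carrier
  ¬ x = x ⇾ 𝟘

open FLew public

data Arrow : Set where
  ⇒∘ ⇒∧ : Arrow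

arr : Arrow → (A : FLew) → Carrier A → Carrier A → Carrier A
arr ⇒∘ A x y = _·_ A (_⇾_ A x y) (_⇾_ A y (¬_ A (¬_ A x)))
arr ⇒∧ A x y = _⊓_ A (_⇾_ A x y) (_⇾_ A y (¬_ A (¬_ A x)))

module _ (r : Arrow) (A : FLew) where
  private
    _⇒_ = arr r A
    ¬' = ¬_ A
    1≤ : Carrier A → Set
    1≤ t = _≤_ A (𝟙 A) t

  AT : Set
  AT = ∀ x → 1≤ (¬' (x ⇒ ¬' x))

  AT' : Set
  AT' = ∀ x → 1≤ (¬' (¬' x ⇒ x))

  BT : Set
  BT = ∀ x y → 1≤ ((x ⇒ y) ⇒ ¬' (x ⇒ ¬' y))

  BT' : Set
  BT' = ∀ x y → 1≤ ((x ⇒ ¬' y) ⇒ ¬' (x ⇒ y))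

  BTw : Set
  BTw = ∀ x y → 1≤ (x ⇒ y) → 1≤ (¬' (x ⇒ ¬' y))

  BTw' : Set
  BTw' = ∀ x y → 1≤ (x ⇒ ¬' y) → 1≤ (¬' (x ⇒ y))

  ProtoAlg : Set
  ProtoAlg = AT × AT' × BT × BT'

  WeakAlg : Set
  WeakAlg = AT × AT' × BTw × BTw'

ProtoConnexive : ∀ {ℓ} → Arrow → Pred FLew ℓ → Set (lsuc 0ℓ ⊔ ℓ)
ProtoConnexive r K = ∀ A → K A → ProtoAlg r A

WeaklyConnexive : ∀ {ℓ} → Arrow → Pred FLew ℓ → Set (lsuc 0ℓ ⊔ ℓ)
WeaklyConnexive r K = ∀ A → K A → WeakAlg r A

Qw : ∀ {ℓ} → Arrow → Pred FLew ℓ → Pred FLew ℓ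
Qw r V A = V A × WeakAlg r A

data Term : Set where
  var : ℕ → Term
  _∧ₜ_ _∨ₜ_ _·ₜ_ _→ₜ_ : Term → Term → Term
  0ₜ 1ₜ : Term

⟦_⟧ : ∀ {A : FLew} → Term → (ℕ → Carrier A) → Carrier A
⟦_⟧ (var i) ρ = ρ i
⟦_⟧ {A} (s ∧ₜ t) ρ = _⊓_ A (⟦_⟧ {A} s ρ) (⟦_⟧ {A} t ρ)
⟦_⟧ {A} (s ∨ₜ t) ρ = _⊔ₗ_ A (⟦_⟧ {A} s ρ) (⟦_⟧ {A} t ρ)
⟦_⟧ {A} (s ·ₜ t) ρ = _·_ A (⟦_⟧ {A} s ρ) (⟦_⟧ {A} t ρ)
⟦_⟧ {A} (s →ₜ t) ρ = _⇾_ A (⟦_⟧ {A} s ρ) (⟦_⟧ {A} t ρ)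
⟦_⟧ {A} 0ₜ ρ = 𝟘 A
⟦_⟧ {A} 1ₜ ρ = 𝟙 A

Equation : Set
Equation = Term × Term

_⊨_ : FLew → Equation → Set
A ⊨ (s , t) = ∀ (ρ : ℕ → Carrier A) → ⟦_⟧ {A} s ρ ≡ ⟦_⟧ {A} t ρ

-- Mod E: the subvariety of FL_ew axiomatized by the set of equations E
-- (by Birkhoff, every subvariety of FL_ew has this form)
Mod : Pred Equation 0ℓ → Pred FLew 0ℓ
Mod E A = ∀ e → e ∈ E → A ⊨ e

¬ₜ : Term → Term
¬ₜ t = t →ₜ 0ₜ

arrₜ : Arrow → Term → Term → Term
arrₜ ⇒∘ s t = (s →ₜ t) ·ₜ (t →ₜ ¬ₜ (¬ₜ s))
arrₜ ⇒∧ s t = (s →ₜ t) ∧ₜ (t →ₜ ¬ₜ (¬ₜ s))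

-- the inequation 1 ≤ ¬(x ⇒ ¬x), written as the equation 1 ∧ ¬(x ⇒ ¬x) = 1
ATeq : Arrow → Equation
ATeq r = (1ₜ ∧ₜ ¬ₜ (arrₜ r x (¬ₜ x))) , 1ₜ
  where x = var 0

ATset : Arrow → Pred Equation 0ℓ
ATset r e = e ≡ ATeq r

-- Everything follows from (AT). For both arrows, x ⇒ y lies between
-- (x → y)·(y → ¬¬x) and each of its two factors, so 𝟙 ≤ x ⇒ y iff x ≤ y ≤ ¬¬x.
-- Hence (AT) forbids nonzero elements of square 𝟘 (if t·t ≤ 𝟘 then t ≤ t ⇒ ¬t),
-- and so every s with s ≤ a → ¬a and s ≤ ¬a → ¬¬a is 𝟘, since s·s ≤ a ⇒ ¬a.
-- Each of (AT'), (BT), (BT'), (BTw), (BTw') is an instance of this refutation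
-- scheme, so the weakly and the proto-connexive algebras are both exactly the
-- models of the single equation (AT).
module Submission where

open import Defs
  using ( FLew; module FLew; Arrow; ⇒∘; ⇒∧; arr; AT; AT'; BT; BT'; BTw; BTw'
        ; ProtoAlg; WeakAlg; ProtoConnexive; WeaklyConnexive; Qw
        ; Equation; _⊨_; Mod; ATeq; ATset )
open import Level using (Level; 0ℓ)
open import Data.Product using (_×_; _,_; proj₁)
open import Data.Sum using (inj₁; inj₂)
open import Function using (const)
open import Function.Bundles using (_⇔_; mk⇔; module Equivalence)
open import Function.Construct.Identity using (⇔-id)
open import Function.Properties.Equivalence using (⇔-setoid)
open import Data.Product.Function.NonDependent.Propositional using (_×-⇔_)
open import Relation.Unary using (Pred; _∪_)
open import Relation.Binary.Bundles using (Poset)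
open import Relation.Binary.Structures using (IsPartialOrder)
open import Relation.Binary.PropositionalEquality
  using (_≡_; refl; sym; cong; subst; isEquivalence)
open import Algebra.Lattice.Bundles using (Lattice)
open import Algebra.Structures using (IsCommutativeMonoid)
open import Algebra.Bundles using (CommutativeSemigroup)
open import Relation.Binary.Lattice.Bundles using (MeetSemilattice)

module FLewProperties (A : FLew) where

  open FLew A renaming
    ( _⊓_ to infixr 7 _⊓_ ; _·_ to infixl 7 _·_ ; _⇾_ to infixr 5 _⇾_
    ; _≤_ to infix 4 _≤_ ; ¬_ to infix 9 ¬_ )
  open IsCommutativeMonoid isCommMonoid using (assoc; comm; identityˡ; isCommutativeSemigroup)

  ·-commutativeSemigroup : CommutativeSemigroup 0ℓ 0ℓ
  ·-commutativeSemigroup = record { isCommutativeSemigroup = isCommutativeSemigroup }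

  open import Algebra.Properties.CommutativeSemigroup ·-commutativeSemigroup using (interchange)

  lattice : Lattice 0ℓ 0ℓ
  lattice = record
    { Carrier = Carrier ; _≈_ = _≡_ ; _∨_ = _⊔ₗ_ ; _∧_ = _⊓_ ; isLattice = isLattice }

  open import Algebra.Lattice.Properties.Lattice lattice
    using (poset; ∧-orderTheoreticMeetSemilattice)

  private
    module Natural = Poset poset
    module Meet = MeetSemilattice ∧-orderTheoreticMeetSemilattice

  variable
    a b c d p q s t w x y z : Carrier

  -- x ≤ y unfolds to x ⊓ y ≡ x, the library's left natural order x ≡ x ⊓ y
  -- read backwards.
  ≤-reflexive : x ≡ y → x ≤ y
  ≤-reflexive x≡y = sym (Natural.reflexive x≡y)

  ≤-refl : x ≤ x
  ≤-refl = ≤-reflexive refl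

  ≤-trans : x ≤ y → y ≤ z → x ≤ z
  ≤-trans x≤y y≤z = sym (Natural.trans (sym x≤y) (sym y≤z))

  ≤-antisym : x ≤ y → y ≤ x → x ≡ y
  ≤-antisym x≤y y≤x = Natural.antisym (sym x≤y) (sym y≤x)

  ≤-isPartialOrder : IsPartialOrder _≡_ _≤_
  ≤-isPartialOrder = record
    { isPreorder = record
      { isEquivalence = isEquivalence ; reflexive = ≤-reflexive ; trans = ≤-trans }
    ; antisym = ≤-antisym
    }

  ≤-poset : Poset 0ℓ 0ℓ 0ℓ
  ≤-poset = record { isPartialOrder = ≤-isPartialOrder }

  open import Relation.Binary.Reasoning.PartialOrder ≤-poset

  x⊓y≤x : x ⊓ y ≤ x
  x⊓y≤x = sym (Meet.x∧y≤x _ _)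

  x⊓y≤y : x ⊓ y ≤ y
  x⊓y≤y = sym (Meet.x∧y≤y _ _)

  ⊓-greatest : x ≤ y → x ≤ z → x ≤ y ⊓ z
  ⊓-greatest x≤y x≤z = sym (Meet.∧-greatest (sym x≤y) (sym x≤z))

  residuate : x · y ≤ z → x ≤ y ⇾ z
  residuate = residuation-⇒ _ _ _

  unresiduate : x ≤ y ⇾ z → x · y ≤ z
  unresiduate = residuation-⇐ _ _ _

  modus-ponens : (x ⇾ y) · x ≤ y
  modus-ponens = unresiduate ≤-refl

  ·-monoˡ-≤ : x ≤ y → x · z ≤ y · z
  ·-monoˡ-≤ x≤y = unresiduate (≤-trans x≤y (residuate ≤-refl))

  ·-monoʳ-≤ : x ≤ y → z · x ≤ z · y
  ·-monoʳ-≤ {x} {y} {z} x≤y = begin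
    z · x  ≡⟨ comm z x ⟩
    x · z  ≤⟨ ·-monoˡ-≤ x≤y ⟩
    y · z  ≡⟨ comm y z ⟩
    z · y  ∎

  ·-mono-≤ : a ≤ b → c ≤ d → a · c ≤ b · d
  ·-mono-≤ a≤b c≤d = ≤-trans (·-monoˡ-≤ a≤b) (·-monoʳ-≤ c≤d)

  ·-comm-≤ : x · y ≤ z → y · x ≤ z
  ·-comm-≤ {x} {y} = subst (_≤ _) (comm x y)

  x·y≤y : x · y ≤ y
  x·y≤y {x} {y} = begin
    x · y  ≤⟨ ·-monoˡ-≤ (𝟙-top x) ⟩
    𝟙 · y  ≡⟨ identityˡ y ⟩
    y      ∎

  x·y≤x : x · y ≤ x
  x·y≤x = ·-comm-≤ x·y≤y

  ⇾-monoʳ-≤ : y ≤ z → x ⇾ y ≤ x ⇾ z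
  ⇾-monoʳ-≤ y≤z = residuate (≤-trans modus-ponens y≤z)

  𝟙≤⇾⇒≤ : 𝟙 ≤ x ⇾ y → x ≤ y
  𝟙≤⇾⇒≤ {x} 𝟙≤x⇾y = subst (_≤ _) (identityˡ x) (unresiduate 𝟙≤x⇾y)

  ≤⇒𝟙≤⇾ : x ≤ y → 𝟙 ≤ x ⇾ y
  ≤⇒𝟙≤⇾ {x} x≤y = residuate (subst (_≤ _) (sym (identityˡ x)) x≤y)

  x·¬x≤𝟘 : x · ¬ x ≤ 𝟘
  x·¬x≤𝟘 = ·-comm-≤ modus-ponens

  x≤¬¬x : x ≤ ¬ ¬ x
  x≤¬¬x = residuate x·¬x≤𝟘

  ¬-antitone : x ≤ y → ¬ y ≤ ¬ x
  ¬-antitone x≤y = residuate (≤-trans (·-monoʳ-≤ x≤y) modus-ponens)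

  ¬¬¬x≡¬x : ¬ ¬ ¬ x ≡ ¬ x
  ¬¬¬x≡¬x = ≤-antisym (¬-antitone x≤¬¬x) x≤¬¬x

  x≤y≤¬¬x⇒¬y≡¬x : x ≤ y → y ≤ ¬ ¬ x → ¬ y ≡ ¬ x
  x≤y≤¬¬x⇒¬y≡¬x {x} {y} x≤y y≤¬¬x =
    ≤-antisym (¬-antitone x≤y) (subst (_≤ ¬ y) ¬¬¬x≡¬x (¬-antitone y≤¬¬x))

  ¬x≤x⇾y : ¬ x ≤ x ⇾ y
  ¬x≤x⇾y = residuate (≤-trans modus-ponens (𝟘-bot _))

  y≤x⇾y : y ≤ x ⇾ y
  y≤x⇾y = residuate x·y≤x

  contraposition : x ⇾ y ≤ ¬ y ⇾ ¬ x
  contraposition {x} {y} = residuate (residuate (begin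
    (x ⇾ y) · ¬ y · x    ≡⟨ assoc (x ⇾ y) (¬ y) x ⟩
    (x ⇾ y) · (¬ y · x)  ≡⟨ cong ((x ⇾ y) ·_) (comm (¬ y) x) ⟩
    (x ⇾ y) · (x · ¬ y)  ≡⟨ assoc (x ⇾ y) x (¬ y) ⟨
    (x ⇾ y) · x · ¬ y    ≤⟨ ·-monoˡ-≤ modus-ponens ⟩
    y · ¬ y              ≤⟨ x·¬x≤𝟘 ⟩
    𝟘                    ∎))

  y⇾¬¬x≤¬x⇾¬y : y ⇾ ¬ ¬ x ≤ ¬ x ⇾ ¬ y
  y⇾¬¬x≤¬x⇾¬y {y} {x} = subst (λ n → y ⇾ ¬ ¬ x ≤ n ⇾ ¬ y) ¬¬¬x≡¬x contraposition

  p·q≤w⇒¬w·p≤¬q : p · q ≤ w → ¬ w · p ≤ ¬ q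
  p·q≤w⇒¬w·p≤¬q {p} {q} {w} p·q≤w = residuate (begin
    ¬ w · p · q    ≡⟨ assoc (¬ w) p q ⟩
    ¬ w · (p · q)  ≤⟨ ·-monoʳ-≤ p·q≤w ⟩
    ¬ w · w        ≤⟨ ·-comm-≤ x·¬x≤𝟘 ⟩
    𝟘              ∎)

  contradictory : p · a ≤ c → q · a ≤ ¬ c → p · q ≤ a ⇾ ¬ a
  contradictory {p} {a} {c} {q} p·a≤c q·a≤¬c = residuate (residuate (begin
    p · q · a · a        ≡⟨ assoc (p · q) a a ⟩
    p · q · (a · a)      ≡⟨ interchange p q a a ⟩
    (p · a) · (q · a)    ≤⟨ ·-mono-≤ p·a≤c q·a≤¬c ⟩
    c · ¬ c              ≤⟨ x·¬x≤𝟘 ⟩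
    𝟘                    ∎))

  ⇒-lower : ∀ r → (x ⇾ y) · (y ⇾ ¬ ¬ x) ≤ arr r A x y
  ⇒-lower ⇒∘ = ≤-refl
  ⇒-lower ⇒∧ = ⊓-greatest x·y≤x x·y≤y

  ⇒-upperˡ : ∀ r → arr r A x y ≤ x ⇾ y
  ⇒-upperˡ ⇒∘ = x·y≤x
  ⇒-upperˡ ⇒∧ = x⊓y≤x

  ⇒-upperʳ : ∀ r → arr r A x y ≤ y ⇾ ¬ ¬ x
  ⇒-upperʳ ⇒∘ = x·y≤y
  ⇒-upperʳ ⇒∧ = x⊓y≤y

  module _ (r : Arrow) where

    infixr 5 _⇒_
    _⇒_ : Carrier → Carrier → Carrier
    _⇒_ = arr r A

    ⇒-greatest : s ≤ x ⇾ y → t ≤ y ⇾ ¬ ¬ x → s · t ≤ x ⇒ y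
    ⇒-greatest s≤ t≤ = ≤-trans (·-mono-≤ s≤ t≤) (⇒-lower r)

    𝟙≤⇒-elim : 𝟙 ≤ x ⇒ y → x ≤ y × y ≤ ¬ ¬ x
    𝟙≤⇒-elim 𝟙≤ = 𝟙≤⇾⇒≤ (≤-trans 𝟙≤ (⇒-upperˡ r)) , 𝟙≤⇾⇒≤ (≤-trans 𝟙≤ (⇒-upperʳ r))

    𝟙≤⇒-intro : x ≤ y → y ≤ ¬ ¬ x → 𝟙 ≤ x ⇒ y
    𝟙≤⇒-intro x≤y y≤¬¬x =
      ≤-trans (≤-reflexive (sym (identityˡ 𝟙))) (⇒-greatest (≤⇒𝟙≤⇾ x≤y) (≤⇒𝟙≤⇾ y≤¬¬x))

    ¬x·¬y≤x⇒y : ¬ x · ¬ y ≤ x ⇒ y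
    ¬x·¬y≤x⇒y = ⇒-greatest ¬x≤x⇾y ¬x≤x⇾y

    ¬¬x·y≤x⇒y : ¬ ¬ x · y ≤ x ⇒ y
    ¬¬x·y≤x⇒y = ·-comm-≤ (⇒-greatest y≤x⇾y y≤x⇾y)

    module _ (at : AT r A) where

      x⇒¬x≤𝟘 : x ⇒ ¬ x ≤ 𝟘
      x⇒¬x≤𝟘 = 𝟙≤⇾⇒≤ (at _)

      t·t≤𝟘⇒t≤𝟘 : t · t ≤ 𝟘 → t ≤ 𝟘
      t·t≤𝟘⇒t≤𝟘 {t} t·t≤𝟘 = begin
        t          ≡⟨ identityˡ t ⟨
        𝟙 · t      ≤⟨ ⇒-greatest (≤⇒𝟙≤⇾ (residuate t·t≤𝟘)) (≤-trans x≤¬¬x y≤x⇾y) ⟩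
        t ⇒ ¬ t    ≤⟨ x⇒¬x≤𝟘 ⟩
        𝟘          ∎

      refute : s ≤ a ⇾ ¬ a → s ≤ ¬ a ⇾ ¬ ¬ a → s ≤ 𝟘
      refute s≤ s≤′ = t·t≤𝟘⇒t≤𝟘 (≤-trans (⇒-greatest s≤ s≤′) x⇒¬x≤𝟘)

      incompatible : (x ⇒ y) · (x ⇒ ¬ y) ≤ 𝟘
      incompatible = refute
        (contradictory (unresiduate (⇒-upperˡ r)) (unresiduate (⇒-upperˡ r)))
        (contradictory (unresiduate (≤-trans (⇒-upperʳ r) y⇾¬¬x≤¬x⇾¬y))
                       (unresiduate (≤-trans (⇒-upperʳ r) y⇾¬¬x≤¬x⇾¬y)))

      ¬-incompatible : ¬ (x ⇒ y) · ¬ (x ⇒ ¬ y) ≤ 𝟘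
      ¬-incompatible = refute
        (contradictory (p·q≤w⇒¬w·p≤¬q ¬x·¬y≤x⇒y) (p·q≤w⇒¬w·p≤¬q ¬x·¬y≤x⇒y))
        (contradictory (p·q≤w⇒¬w·p≤¬q ¬¬x·y≤x⇒y) (p·q≤w⇒¬w·p≤¬q ¬¬x·y≤x⇒y))

      a·b≤𝟘⇒𝟙≤a⇒¬b : a · b ≤ 𝟘 → ¬ b · ¬ a ≤ 𝟘 → 𝟙 ≤ a ⇒ ¬ b
      a·b≤𝟘⇒𝟙≤a⇒¬b a·b≤𝟘 ¬b·¬a≤𝟘 = 𝟙≤⇒-intro (residuate a·b≤𝟘) (residuate ¬b·¬a≤𝟘)

      at′ : AT' r A
      at′ x = ≤⇒𝟙≤⇾ (refute
        (subst (λ n → ¬ x ⇒ x ≤ x ⇾ n) ¬¬¬x≡¬x (⇒-upperʳ r))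
        (≤-trans (⇒-upperˡ r) (⇾-monoʳ-≤ x≤¬¬x)))

      bt : BT r A
      bt x y = a·b≤𝟘⇒𝟙≤a⇒¬b incompatible (·-comm-≤ ¬-incompatible)

      bt′ : BT' r A
      bt′ x y = a·b≤𝟘⇒𝟙≤a⇒¬b (·-comm-≤ incompatible) ¬-incompatible

      btw : BTw r A
      btw x y 𝟙≤x⇒y = ≤⇒𝟙≤⇾ (subst (λ n → x ⇒ n ≤ 𝟘) (sym ¬y≡¬x) x⇒¬x≤𝟘)
        where
        ¬y≡¬x : ¬ y ≡ ¬ x
        ¬y≡¬x = let x≤y , y≤¬¬x = 𝟙≤⇒-elim 𝟙≤x⇒y in x≤y≤¬¬x⇒¬y≡¬x x≤y y≤¬¬x

      btw′ : BTw' r A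
      btw′ x y 𝟙≤x⇒¬y = ≤⇒𝟙≤⇾ (refute
        (subst (λ n → x ⇒ y ≤ y ⇾ n) ¬¬x≡¬y (⇒-upperʳ r))
        (subst (λ n → x ⇒ y ≤ ¬ y ⇾ n) (sym ¬¬y≡¬x) (≤-trans (⇒-upperˡ r) contraposition)))
        where
        ¬¬y≡¬x : ¬ ¬ y ≡ ¬ x
        ¬¬y≡¬x = let x≤¬y , ¬y≤¬¬x = 𝟙≤⇒-elim 𝟙≤x⇒¬y in x≤y≤¬¬x⇒¬y≡¬x x≤¬y ¬y≤¬¬x
        ¬¬x≡¬y : ¬ ¬ x ≡ ¬ y
        ¬¬x≡¬y = subst (λ n → ¬ n ≡ ¬ y) ¬¬y≡¬x ¬¬¬x≡¬x

      AT⇒WeakAlg : WeakAlg r A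
      AT⇒WeakAlg = at , at′ , btw , btw′

      AT⇒ProtoAlg : ProtoAlg r A
      AT⇒ProtoAlg = at , at′ , bt , bt′

open FLewProperties using (AT⇒WeakAlg; AT⇒ProtoAlg)

⊨ATeq⇔AT : ∀ r (A : FLew) → A ⊨ ATeq r ⇔ AT r A
⊨ATeq⇔AT ⇒∘ A = mk⇔ (λ h x → h (const x)) (λ h ρ → h (ρ 0))
⊨ATeq⇔AT ⇒∧ A = mk⇔ (λ h x → h (const x)) (λ h ρ → h (ρ 0))

Mod-ATset⇔AT : ∀ r (A : FLew) → Mod (ATset r) A ⇔ AT r A
Mod-ATset⇔AT r A = mk⇔
  (λ h → Equivalence.to (⊨ATeq⇔AT r A) (h (ATeq r) refl))
  (λ { h _ refl → Equivalence.from (⊨ATeq⇔AT r A) h })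

Mod-∪⇔× : ∀ (E F : Pred Equation 0ℓ) (A : FLew) → Mod (E ∪ F) A ⇔ (Mod E A × Mod F A)
Mod-∪⇔× E F A = mk⇔
  (λ h → (λ e e∈E → h e (inj₁ e∈E)) , (λ e e∈F → h e (inj₂ e∈F)))
  (λ { (hE , _) e (inj₁ e∈E) → hE e e∈E ; (_ , hF) e (inj₂ e∈F) → hF e e∈F })

WeakAlg⇔AT : ∀ r (A : FLew) → WeakAlg r A ⇔ AT r A
WeakAlg⇔AT r A = mk⇔ proj₁ (AT⇒WeakAlg A r)

theorem4p9 : ∀ {ℓ : Level} (r : Arrow) →
    ((K : Pred FLew ℓ) → WeaklyConnexive r K ⇔ ProtoConnexive r K)
    × ((E : Pred Equation 0ℓ) (A : FLew) → Qw r (Mod E) A ⇔ Mod (E ∪ ATset r) A)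
theorem4p9 r =
    (λ K → mk⇔ (λ weak A A∈K → AT⇒ProtoAlg A r (proj₁ (weak A A∈K)))
               (λ proto A A∈K → AT⇒WeakAlg A r (proj₁ (proto A A∈K))))
  , λ E A → begin
      Qw r (Mod E) A               ≡⟨⟩
      (Mod E A × WeakAlg r A)      ≈⟨ ⇔-id _ ×-⇔ WeakAlg⇔AT r A ⟩
      (Mod E A × AT r A)           ≈⟨ ⇔-id _ ×-⇔ Mod-ATset⇔AT r A ⟨
      (Mod E A × Mod (ATset r) A)  ≈⟨ Mod-∪⇔× E (ATset r) A ⟨
      Mod (E ∪ ATset r) A          ∎
  where open import Relation.Binary.Reasoning.Setoid (⇔-setoid 0ℓ)
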